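{- Let $G$ be a ribbon graph written as a sequence of $1$-sums $G=H_1\oplus H_2\oplus\cdots\oplus H_l$. Then for each $i$, $G$ can be written as a sequence of $1$-sums in which $H_i$ is the first $1$-summand: $G=H_i\oplus H_{\iota_2}\oplus\cdots\oplus H_{\iota_l}$, where $(i,\iota_2,\dots,\iota_l)$ is a permutation of $(1,\dots,l)$.
   Context: A ribbon graph is a surface with boundary made of vertex discs and edge discs meeting in disjoint segments, each segment on the boundary of exactly one vertex and one edge, each edge containing exactly two segments. A $1$-sum: a connected ribbon graph $G$ is $P\oplus Q$ if $P,Q$ are non-trivial (not a single isolated vertex) connected ribbon subgraphs with $G=P\cup Q$ and $P\cap Q$ a single vertex. $G$ can be written as a sequence of $1$-sums $G=H_1\oplus\cdots\oplus H_l$ if $G$ contains ribbon subgraphs $H_1,\dots,H_l$ with $G=(\cdots((H_1\oplus H_2)\oplus H_3)\oplus\cdots)\oplus H_l$, each step being a $1$-sum of connected ribbon subgraphs. -}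

module Defs where

open import Data.Nat using (ℕ; suc)
open import Data.Fin using (Fin; zero; suc)
open import Data.Fin.Subset as S using (Subset; _∈_; _∪_; _∩_; ⁅_⁆)
open import Data.Bool using (Bool)
open import Data.Product using (Σ; ∃; _×_; _,_)
open import Data.Sum using (_⊎_)
open import Data.List using (List; []; _∷_; _++_)
open import Data.List.Relation.Unary.Unique.Propositional using (Unique)
import Data.List.Membership.Propositional as LM
import Data.Fin.Subset.Properties as SP
import Data.Sum
open import Relation.Binary.PropositionalEquality using (_≡_)
open import Relation.Binary.Construct.Closure.ReflexiveTransitive using (Star)
open import Relation.Nullary using (¬_)
open import Function.Bundles using (_⇔_)

-- A ribbon graph, given combinatorially as a signed rotation system
-- (the standard equivalent description of a ribbon graph):
--  * vertices Fin nV (vertex discs), edges Fin nE (edge discs);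
--  * each edge e has two ends (e , 0) and (e , 1); end e s is the vertex
--    disc that the s-th end of e is attached to (loops allowed);
--  * rotation v : the cyclic order (read from a list) of edge-ends around
--    the vertex disc v; every end attached to v occurs exactly once;
--  * twist e : whether the edge disc e is twisted.
record RibbonGraph : Set where
  field
    nV nE    : ℕ
    end      : Fin nE → Fin 2 → Fin nV
    rotation : Fin nV → List (Fin nE × Fin 2)
    rotation-unique : ∀ v → Unique (rotation v)
    rotation-ends   : ∀ v e s → (LM._∈_ (e , s) (rotation v)) ⇔ (end e s ≡ v)
    twist    : Fin nE → Bool
open RibbonGraph public

record Sub (G : RibbonGraph) : Set where
  constructor sub
  field
    vs     : Subset (nV G)
    es     : Subset (nE G)
    closed : ∀ e s → e ∈ es → end G e s ∈ vs
open Sub public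

module _ {G : RibbonGraph} where

  whole : Sub G
  whole = sub S.⊤ S.⊤ (λ e s _ → SP.∈⊤)

  _∪ᴿ_ : Sub G → Sub G → Sub G
  P ∪ᴿ Q = sub (vs P ∪ vs Q) (es P ∪ es Q) cl
    where
    cl : ∀ e s → e ∈ (es P ∪ es Q) → end G e s ∈ (vs P ∪ vs Q)
    cl e s h with SP.x∈p∪q⁻ (es P) (es Q) h
    ... | Data.Sum.inj₁ p = SP.x∈p∪q⁺ (Data.Sum.inj₁ (closed P e s p))
    ... | Data.Sum.inj₂ q = SP.x∈p∪q⁺ (Data.Sum.inj₂ (closed Q e s q))

  _≈ᴿ_ : Sub G → Sub G → Set
  P ≈ᴿ Q = (vs P ≡ vs Q) × (es P ≡ es Q)

  Adj : Sub G → Fin (nV G) → Fin (nV G) → Set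
  Adj P u w = ∃ λ e → e ∈ es P ×
      ((end G e zero ≡ u × end G e (suc zero) ≡ w)
     ⊎ (end G e (suc zero) ≡ u × end G e zero ≡ w))

  Connected : Sub G → Set
  Connected P = (∃ λ v → v ∈ vs P)
              × (∀ u w → u ∈ vs P → w ∈ vs P → Star (Adj P) u w)

  Trivial : Sub G → Set
  Trivial P = (es P ≡ S.⊥) × (∃ λ v → vs P ≡ ⁅ v ⁆)

  IsOneSum : Sub G → Sub G → Sub G → Set
  IsOneSum K P Q =
      Connected K
    × Connected P × ¬ Trivial P
    × Connected Q × ¬ Trivial Q
    × K ≈ᴿ (P ∪ᴿ Q)
    × (∃ λ v → vs P ∩ vs Q ≡ ⁅ v ⁆)
    × (es P ∩ es Q ≡ S.⊥)

  -- SumSeq K (H₁ ∷ … ∷ Hₗ) : K = (⋯((H₁ ⊕ H₂) ⊕ H₃) ⊕ ⋯) ⊕ Hₗ,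
  -- each step a 1-sum of connected ribbon subgraphs.
  data SumSeq : Sub G → List (Sub G) → Set where
    one  : ∀ {K H} → K ≈ᴿ H → SumSeq K (H ∷ [])
    step : ∀ {K' K hs H} → SumSeq K hs → IsOneSum K' K H
         → SumSeq K' (hs ++ (H ∷ []))

-- Induct on l, writing G = G′ ⊕ H_l with G′ = H_1 ⊕ ⋯ ⊕ H_{l-1}. For i < l,
-- reorder G′ by induction so that H_i comes first and add H_l at the end. For
-- i = l, the vertex where H_l meets G′ lies in some H_j; reorder G′ to start
-- with H_j and put H_l in front. This is legitimate because attaching X at a
-- vertex of the first summand commutes with all later 1-sums:
-- X ⊕ (K ⊕ H) = (X ⊕ K) ⊕ H whenever X meets K ⊕ H inside K.
module Submission where

open import Defs
open import Data.Nat using (ℕ; suc)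
import Data.Nat as ℕ
open import Data.Fin using (Fin; zero; suc; fromℕ; inject₁; punchIn; _≟_)
open import Data.Fin.Relation.Unary.Top using (view; ‵fromℕ; ‵inject₁)
open import Data.Fin.Permutation using (Permutation; Permutation′; _⟨$⟩ʳ_; insert; insert-punchIn; id)
open import Data.Fin.Subset using (Subset; _∈_; _⊆_; _∪_; _∩_; ⁅_⁆; ⊥; Nonempty)
open import Data.Fin.Subset.Properties
  using (x∈⁅x⁆; x∈⁅y⁆⇒x≡y; ⊆-antisym; ⊆-trans; ⊥⊆; p⊆p∪q; q⊆p∪q; x∈p∪q⁻;
         x∈p∩q⁺; x∈p∩q⁻; ∪-assoc; ∪-comm; ∩-comm)
open import Data.List using (List; []; _∷_; _∷ʳ_; tabulate)
open import Data.List.Properties using (tabulate-cong; ∷ʳ-injective; ∷-injectiveˡ)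
open import Data.List.Relation.Unary.Any using (Any; here)
open import Data.List.Relation.Unary.Any.Properties using (++⁺ˡ; ++⁺ʳ; tabulate⁻)
open import Data.Product using (Σ; ∃; _×_; _,_; proj₁; proj₂)
open import Data.Sum using (inj₁; inj₂)
open import Function using (_∘_)
open import Relation.Binary.Construct.Closure.ReflexiveTransitive using (Star; _◅◅_; gmap)
open import Relation.Binary.PropositionalEquality
open import Relation.Nullary using (¬_)
open import Relation.Nullary.Decidable using (dec-yes)

private
  variable
    n : ℕ
    p q r : Subset n

p≡⁅x⁆⇒x∈p : ∀ {x} → p ≡ ⁅ x ⁆ → x ∈ p
p≡⁅x⁆⇒x∈p {x = x} p≡⁅x⁆ = subst (x ∈_) (sym p≡⁅x⁆) (x∈⁅x⁆ x)

p≡⁅x⁆∧x∈q⇒p⊆q : ∀ {x} → p ≡ ⁅ x ⁆ → x ∈ q → p ⊆ q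
p≡⁅x⁆∧x∈q⇒p⊆q {q = q} {x} p≡⁅x⁆ x∈q y∈p =
  subst (_∈ q) (sym (x∈⁅y⁆⇒x≡y x (subst (_ ∈_) p≡⁅x⁆ y∈p))) x∈q

∩-monoʳ-⊆ : q ⊆ r → p ∩ q ⊆ p ∩ r
∩-monoʳ-⊆ {q = q} {p = p} q⊆r x∈p∩q =
  let x∈p , x∈q = x∈p∩q⁻ p q x∈p∩q in x∈p∩q⁺ (x∈p , q⊆r x∈q)

module _ {p q r : Subset n} (p∩[q∪r]⊆q : p ∩ (q ∪ r) ⊆ q) where

  p∩q≡p∩[q∪r] : p ∩ q ≡ p ∩ (q ∪ r)
  p∩q≡p∩[q∪r] = ⊆-antisym (∩-monoʳ-⊆ (p⊆p∪q r))
    (λ x∈ → x∈p∩q⁺ (proj₁ (x∈p∩q⁻ p _ x∈) , p∩[q∪r]⊆q x∈))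

  [p∪q]∩r≡q∩r : (p ∪ q) ∩ r ≡ q ∩ r
  [p∪q]∩r≡q∩r = ⊆-antisym ⊆q∩r
    (λ x∈ → let x∈q , x∈r = x∈p∩q⁻ q r x∈ in x∈p∩q⁺ (q⊆p∪q p q x∈q , x∈r))
    where
    ⊆q∩r : (p ∪ q) ∩ r ⊆ q ∩ r
    ⊆q∩r x∈ with x∈p∩q⁻ (p ∪ q) r x∈
    ... | x∈p∪q , x∈r with x∈p∪q⁻ p q x∈p∪q
    ... | inj₁ x∈p = x∈p∩q⁺ (p∩[q∪r]⊆q (x∈p∩q⁺ (x∈p , q⊆p∪q q r x∈r)) , x∈r)
    ... | inj₂ x∈q = x∈p∩q⁺ (x∈q , x∈r)

punchIn-fromℕ : ∀ {n} (i : Fin n) → punchIn (fromℕ n) i ≡ inject₁ i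
punchIn-fromℕ zero = refl
punchIn-fromℕ (suc i) = cong suc (punchIn-fromℕ i)

insert-self : ∀ {m n} i j (π : Permutation m n) → insert i j π ⟨$⟩ʳ i ≡ j
insert-self i j π rewrite proj₂ (dec-yes (i ≟ i) refl) = refl

insert-fromℕ-inject₁ : ∀ {m n} (π : Permutation m n) i →
  insert (fromℕ m) (fromℕ n) π ⟨$⟩ʳ inject₁ i ≡ inject₁ (π ⟨$⟩ʳ i)
insert-fromℕ-inject₁ {m} {n} π i = begin
  ι ⟨$⟩ʳ inject₁ i             ≡⟨ cong (ι ⟨$⟩ʳ_) (punchIn-fromℕ i) ⟨
  ι ⟨$⟩ʳ punchIn (fromℕ m) i   ≡⟨ insert-punchIn (fromℕ m) (fromℕ n) π i ⟩
  punchIn (fromℕ n) (π ⟨$⟩ʳ i) ≡⟨ punchIn-fromℕ (π ⟨$⟩ʳ i) ⟩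
  inject₁ (π ⟨$⟩ʳ i)           ∎
  where
  open ≡-Reasoning
  ι = insert (fromℕ m) (fromℕ n) π

tabulate-∷ʳ : ∀ {a} {A : Set a} {n} (f : Fin (suc n) → A) →
  tabulate f ≡ tabulate (f ∘ inject₁) ∷ʳ f (fromℕ n)
tabulate-∷ʳ {n = ℕ.zero} f = refl
tabulate-∷ʳ {n = suc n} f = cong (f zero ∷_) (tabulate-∷ʳ (f ∘ suc))

module _ {G : RibbonGraph} where

  oneSum-comm : {K P Q : Sub G} → IsOneSum K P Q → IsOneSum K Q P
  oneSum-comm {P = P} {Q} (cK , cP , ntP , cQ , ntQ , (vK , eK) , (v , vP∩Q) , eP∩Q) =
    cK , cQ , ntQ , cP , ntP
    , (trans vK (∪-comm (vs P) (vs Q)) , trans eK (∪-comm (es P) (es Q)))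
    , (v , trans (∩-comm (vs Q) (vs P)) vP∩Q) , trans (∩-comm (es Q) (es P)) eP∩Q

  oneSum-⊆ˡ : {K P Q : Sub G} → IsOneSum K P Q → vs P ⊆ vs K
  oneSum-⊆ˡ {Q = Q} (_ , _ , _ , _ , _ , (vK , _) , _) x∈P = subst (_ ∈_) (sym vK) (p⊆p∪q (vs Q) x∈P)

  ∪ᴿ-connected : {P Q : Sub G} {v : Fin (nV G)} → Connected P → Connected Q
    → v ∈ vs P ∩ vs Q → Connected (P ∪ᴿ Q)
  ∪ᴿ-connected {P} {Q} {v} ((x , x∈P) , walkP) (_ , walkQ) v∈P∩Q = (x , p⊆p∪q (vs Q) x∈P) , walk
    where
    v∈P = proj₁ (x∈p∩q⁻ (vs P) (vs Q) v∈P∩Q)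
    v∈Q = proj₂ (x∈p∩q⁻ (vs P) (vs Q) v∈P∩Q)
    inP : ∀ {a b} → Star (Adj P) a b → Star (Adj (P ∪ᴿ Q)) a b
    inP = gmap (λ a → a) (λ (e , e∈P , ends) → e , p⊆p∪q (es Q) e∈P , ends)
    inQ : ∀ {a b} → Star (Adj Q) a b → Star (Adj (P ∪ᴿ Q)) a b
    inQ = gmap (λ a → a) (λ (e , e∈Q , ends) → e , q⊆p∪q (es P) (es Q) e∈Q , ends)
    walk : ∀ u w → u ∈ vs P ∪ vs Q → w ∈ vs P ∪ vs Q → Star (Adj (P ∪ᴿ Q)) u w
    walk u w u∈ w∈ with x∈p∪q⁻ (vs P) (vs Q) u∈ | x∈p∪q⁻ (vs P) (vs Q) w∈
    ... | inj₁ u∈P | inj₁ w∈P = inP (walkP u w u∈P w∈P)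
    ... | inj₁ u∈P | inj₂ w∈Q = inP (walkP u v u∈P v∈P) ◅◅ inQ (walkQ v w v∈Q w∈Q)
    ... | inj₂ u∈Q | inj₁ w∈P = inQ (walkQ u v u∈Q v∈Q) ◅◅ inP (walkP v w v∈P w∈P)
    ... | inj₂ u∈Q | inj₂ w∈Q = inQ (walkQ u w u∈Q w∈Q)

  ∪ᴿ-nontrivialˡ : {P Q : Sub G} → Nonempty (vs P) → ¬ Trivial P → ¬ Trivial (P ∪ᴿ Q)
  ∪ᴿ-nontrivialˡ {P} {Q} (y , y∈P) ntP (noEdges , x , vs≡⁅x⁆) = ntP (esP≡⊥ , x , vsP≡⁅x⁆)
    where
    inUnion : vs P ⊆ ⁅ x ⁆
    inUnion z∈P = subst (_ ∈_) vs≡⁅x⁆ (p⊆p∪q (vs Q) z∈P)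
    esP≡⊥ : es P ≡ ⊥
    esP≡⊥ = ⊆-antisym (λ e∈P → subst (_ ∈_) noEdges (p⊆p∪q (es Q) e∈P)) ⊥⊆
    vsP≡⁅x⁆ : vs P ≡ ⁅ x ⁆
    vsP≡⁅x⁆ = ⊆-antisym inUnion
      (p≡⁅x⁆∧x∈q⇒p⊆q refl (subst (_∈ vs P) (x∈⁅y⁆⇒x≡y x (inUnion y∈P)) y∈P))

  oneSum-reassoc : {K′ X K K₀ H : Sub G} → IsOneSum K′ X K → IsOneSum K K₀ H
    → vs X ∩ vs K ⊆ vs K₀
    → IsOneSum (X ∪ᴿ K₀) X K₀ × IsOneSum K′ (X ∪ᴿ K₀) H
  oneSum-reassoc {sub _ _ _} {X} {sub _ _ _} {K₀} {H}
    (cK′ , cX , ntX , _ , _ , (refl , refl) , (v , vX∩K) , eX∩K)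
    (_ , cK₀ , ntK₀ , cH , ntH , (refl , refl) , (w , vK₀∩H) , eK₀∩H) glue =
      (cX∪K₀ , cX , ntX , cK₀ , ntK₀ , (refl , refl) , (v , vX∩K₀) , eX∩K₀)
    , (cK′ , cX∪K₀ , ∪ᴿ-nontrivialˡ {X} {K₀} (proj₁ cX) ntX , cH , ntH
      , (sym (∪-assoc (vs X) (vs K₀) (vs H)) , sym (∪-assoc (es X) (es K₀) (es H)))
      , (w , trans ([p∪q]∩r≡q∩r glue) vK₀∩H) , trans ([p∪q]∩r≡q∩r edgeGlue) eK₀∩H)
    where
    edgeGlue : es X ∩ (es K₀ ∪ es H) ⊆ es K₀
    edgeGlue e∈ = ⊥⊆ (subst (_ ∈_) eX∩K e∈)
    vX∩K₀ : vs X ∩ vs K₀ ≡ ⁅ v ⁆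
    vX∩K₀ = trans (p∩q≡p∩[q∪r] glue) vX∩K
    eX∩K₀ : es X ∩ es K₀ ≡ ⊥
    eX∩K₀ = trans (p∩q≡p∩[q∪r] edgeGlue) eX∩K
    cX∪K₀ : Connected (X ∪ᴿ K₀)
    cX∪K₀ = ∪ᴿ-connected {X} {K₀} cX cK₀ (p≡⁅x⁆⇒x∈p vX∩K₀)

  sumSeq-∷ʳ⁻ : {K : Sub G} {ls : List (Sub G)} → SumSeq K ls → ∀ {x xs y} → ls ≡ (x ∷ xs) ∷ʳ y
    → Σ (Sub G) λ K₀ → SumSeq K₀ (x ∷ xs) × IsOneSum K K₀ y
  sumSeq-∷ʳ⁻ (one _) {xs = []} ()
  sumSeq-∷ʳ⁻ (one _) {xs = _ ∷ _} ()
  sumSeq-∷ʳ⁻ (step {K = K₀} {hs} s o) {x} {xs} eq with ∷ʳ-injective hs (x ∷ xs) eq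
  ... | refl , refl = K₀ , s , o

  sumSeq-covers : {K : Sub G} {hs : List (Sub G)} {v : Fin (nV G)} → SumSeq K hs
    → v ∈ vs K → Any (λ h → v ∈ vs h) hs
  sumSeq-covers (one (vK≡vH , _)) v∈K = here (subst (_ ∈_) vK≡vH v∈K)
  sumSeq-covers {v = v} (step {K = K₀} {hs} {H} s (_ , _ , _ , _ , _ , (vK , _) , _)) v∈K
    with x∈p∪q⁻ (vs K₀) (vs H) (subst (v ∈_) vK v∈K)
  ... | inj₁ v∈K₀ = ++⁺ˡ (sumSeq-covers s v∈K₀)
  ... | inj₂ v∈H = ++⁺ʳ hs (here v∈H)

  first : {K : Sub G} {hs : List (Sub G)} → SumSeq K hs → Sub G
  first (one {H = H} _) = H
  first (step s _) = first s

  first-head : {K : Sub G} {hs : List (Sub G)} (s : SumSeq K hs) → ∃ λ t → hs ≡ first s ∷ t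
  first-head (one _) = [] , refl
  first-head (step {H = H} s _) = let t , hs≡ = first-head s in t ∷ʳ H , cong (_∷ʳ H) hs≡

  first-⊆ : {K : Sub G} {hs : List (Sub G)} (s : SumSeq K hs) → vs (first s) ⊆ vs K
  first-⊆ (one (vK≡vH , _)) x∈H = subst (_ ∈_) (sym vK≡vH) x∈H
  first-⊆ (step {K′} {K} {H = H} s o) = oneSum-⊆ˡ {K′} {K} {H} o ∘ first-⊆ s

  sumSeq-∷⁺ : {K′ X K : Sub G} {hs : List (Sub G)} (s : SumSeq K hs) → IsOneSum K′ X K
    → vs X ∩ vs K ⊆ vs (first s) → SumSeq K′ (X ∷ hs)
  -- K and H have the same vertex and edge sets; IsOneSum never inspects the
  -- closure proofs, so after matching the equations o serves for H as well.
  sumSeq-∷⁺ {X = X} {sub _ _ _} (one {H = sub _ _ _} (refl , refl)) o _ =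
    step (one {K = X} {H = X} (refl , refl)) o
  sumSeq-∷⁺ {K′} {X} {K} (step {K = K₀} {H = H} s o₀) o glue =
    step {K = X ∪ᴿ K₀} (sumSeq-∷⁺ {X ∪ᴿ K₀} s (proj₁ reassoc) glue₀) (proj₂ reassoc)
    where
    reassoc : IsOneSum (X ∪ᴿ K₀) X K₀ × IsOneSum K′ (X ∪ᴿ K₀) H
    reassoc = oneSum-reassoc {K′} {X} {K} {K₀} {H} o o₀ (first-⊆ s ∘ glue)
    glue₀ : vs X ∩ vs K₀ ⊆ vs (first s)
    glue₀ = ⊆-trans (∩-monoʳ-⊆ (oneSum-⊆ˡ {K} {K₀} {H} o₀)) glue

  Reordering : {k : ℕ} → Sub G → (Fin (suc k) → Sub G) → Fin (suc k) → Set
  Reordering {k} K H i = Σ (Permutation′ (suc k)) λ ι →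
    (ι ⟨$⟩ʳ zero ≡ i) × SumSeq K (tabulate (λ j → H (ι ⟨$⟩ʳ j)))

  reordering-∷ʳ : ∀ {k} {H : Fin (suc (suc k)) → Sub G} {K K₀ j}
    → Reordering K₀ (H ∘ inject₁) j → IsOneSum K K₀ (H (fromℕ (suc k)))
    → Reordering K H (inject₁ j)
  reordering-∷ʳ {k} {H} {K} (σ , σ0≡j , s) o =
    ι , trans (insert-fromℕ-inject₁ σ zero) (cong inject₁ σ0≡j)
      , subst (SumSeq K) (sym reordered) (step s o)
    where
    ι = insert (fromℕ (suc k)) (fromℕ (suc k)) σ
    reordered : tabulate (H ∘ (ι ⟨$⟩ʳ_))
              ≡ tabulate (H ∘ inject₁ ∘ (σ ⟨$⟩ʳ_)) ∷ʳ H (fromℕ (suc k))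
    reordered = trans (tabulate-∷ʳ (H ∘ (ι ⟨$⟩ʳ_)))
      (cong₂ _∷ʳ_ (tabulate-cong (cong H ∘ insert-fromℕ-inject₁ σ))
                  (cong H (insert-self (fromℕ (suc k)) (fromℕ (suc k)) σ)))

  reordering-∷ : ∀ {k} {H : Fin (suc (suc k)) → Sub G} {K K₀ j}
    → Reordering K₀ (H ∘ inject₁) j → IsOneSum K K₀ (H (fromℕ (suc k)))
    → vs K₀ ∩ vs (H (fromℕ (suc k))) ⊆ vs (H (inject₁ j))
    → Reordering K H (fromℕ (suc k))
  reordering-∷ {k} {H} {K} {K₀} {j} (σ , σ0≡j , s) o glue =
    ι , insert-self zero (fromℕ (suc k)) σ
      , subst (SumSeq K) (sym reordered) (sumSeq-∷⁺ s (oneSum-comm {K} {K₀} {X} o) glue′)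
    where
    X = H (fromℕ (suc k))
    ι = insert zero (fromℕ (suc k)) σ
    reordered : tabulate (H ∘ (ι ⟨$⟩ʳ_)) ≡ X ∷ tabulate (H ∘ inject₁ ∘ (σ ⟨$⟩ʳ_))
    reordered = cong₂ _∷_ (cong H (insert-self zero (fromℕ (suc k)) σ))
      (tabulate-cong λ m →
        cong H (trans (insert-punchIn zero (fromℕ (suc k)) σ m) (punchIn-fromℕ (σ ⟨$⟩ʳ m))))
    Hj≡first : H (inject₁ j) ≡ first s
    Hj≡first = trans (cong (H ∘ inject₁) (sym σ0≡j)) (∷-injectiveˡ (proj₂ (first-head s)))
    glue′ : vs X ∩ vs K₀ ⊆ vs (first s)
    glue′ x∈ = subst (λ h → _ ∈ vs h) Hj≡first (glue (subst (_ ∈_) (∩-comm (vs X) (vs K₀)) x∈))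

  reorder : ∀ k (H : Fin (suc k) → Sub G) {K : Sub G} → SumSeq K (tabulate H) → ∀ i → Reordering K H i
  reorder ℕ.zero H s zero = id , refl , s
  reorder (suc k) H {K} s i with sumSeq-∷ʳ⁻ s (tabulate-∷ʳ H) | view i
  ... | K₀ , s₀ , o | ‵inject₁ j =
    reordering-∷ʳ {H = H} {K} {K₀} (reorder k (H ∘ inject₁) s₀ j) o
  ... | K₀ , s₀ , o@(_ , _ , _ , _ , _ , _ , (v , K₀∩X≡⁅v⁆) , _) | ‵fromℕ
    with tabulate⁻ {f = H ∘ inject₁}
           (sumSeq-covers s₀ (proj₁ (x∈p∩q⁻ (vs K₀) _ (p≡⁅x⁆⇒x∈p K₀∩X≡⁅v⁆))))
  ... | j , v∈Hj =
    reordering-∷ {H = H} {K} {K₀} (reorder k (H ∘ inject₁) s₀ j) o (p≡⁅x⁆∧x∈q⇒p⊆q K₀∩X≡⁅v⁆ v∈Hj)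

proposition3 : (G : RibbonGraph) (k : ℕ) (H : Fin (suc k) → Sub G)
    → SumSeq whole (tabulate H)
    → (i : Fin (suc k))
    → Σ (Permutation′ (suc k)) λ ι →
    (ι ⟨$⟩ʳ zero ≡ i) × SumSeq whole (tabulate (λ j → H (ι ⟨$⟩ʳ j)))
proposition3 G k H s i = reorder k H s i
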